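{- Let $G$ be a graph such that both $G$ and $\overline{G}$ are induced-minor-minimal non-$2$-cographs. Then either $G$ or $\overline{G}$ is critically $2$-connected, or both $G$ and $\overline{G}$ have vertex connectivity exactly two.
   Context: All graphs are finite and simple; $\overline{G}$ denotes the complement of $G$. A graph is $2$-connected if it has at least three vertices, is connected, and has no cut vertex. A $2$-connected graph $H$ is critically $2$-connected if $H-v$ is not $2$-connected for every vertex $v$ of $H$. A graph $G$ is a $2$-cograph if $G$ has no induced subgraph $H$ such that both $H$ and $\overline{H}$ are $2$-connected. For an edge $e$, $G/e$ is the simple graph obtained by contracting $e$ and removing parallel edges. An induced minor of $G$ is a graph obtained from $G$ by a sequence of vertex deletions and edge contractions; it is proper if at least one such operation is performed. An induced-minor-minimal non-$2$-cograph is a graph that is not a $2$-cograph but all of whose proper induced minors are $2$-cographs. -}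

module Defs where

open import Data.Nat using (ℕ; zero; suc; _<_)
open import Data.Bool using (Bool; true; false; not; _∧_; _∨_)
open import Data.Fin using (Fin; zero; suc; punchIn)
open import Data.Fin.Subset using (Subset; _∉_; ∣_∣) renaming (⊥ to ∅; ⁅_⁆ to ⁅_⁆ₛ)
open import Data.Product using (Σ; _×_; _,_)
open import Data.Sum using (_⊎_)
open import Data.Empty using (⊥)
open import Relation.Nullary using (¬_)
open import Relation.Binary.PropositionalEquality using (_≡_; refl; _≢_; cong)

eqF : ∀ {n} → Fin n → Fin n → Bool
eqF zero    zero    = true
eqF zero    (suc _) = false
eqF (suc _) zero    = false
eqF (suc i) (suc j) = eqF i j

eqF-refl : ∀ {n} (i : Fin n) → eqF i i ≡ true
eqF-refl zero    = refl
eqF-refl (suc i) = eqF-refl i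

eqF-sym : ∀ {n} (i j : Fin n) → eqF i j ≡ eqF j i
eqF-sym zero    zero    = refl
eqF-sym zero    (suc _) = refl
eqF-sym (suc _) zero    = refl
eqF-sym (suc i) (suc j) = eqF-sym i j

record Graph (n : ℕ) : Set where
  field
    adj    : Fin n → Fin n → Bool
    sym    : ∀ i j → adj i j ≡ adj j i
    irrefl : ∀ i → adj i i ≡ false
open Graph public

compl : ∀ {n} → Graph n → Graph n
compl G = record
  { adj    = λ i j → not (eqF i j) ∧ not (adj G i j)
  ; sym    = λ i j → sym' i j
  ; irrefl = λ i → irr i }
  where
  sym' : ∀ i j → not (eqF i j) ∧ not (adj G i j) ≡ not (eqF j i) ∧ not (adj G j i)
  sym' i j rewrite eqF-sym i j | sym G i j = refl
  irr : ∀ i → not (eqF i i) ∧ not (adj G i i) ≡ false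
  irr i rewrite eqF-refl i = refl

_─_ : ∀ {m} → Graph (suc m) → Fin (suc m) → Graph m
G ─ v = record
  { adj    = λ i j → adj G (punchIn v i) (punchIn v j)
  ; sym    = λ i j → sym G (punchIn v i) (punchIn v j)
  ; irrefl = λ i → irrefl G (punchIn v i) }

private
  swap∨ : ∀ a b c → a ∨ b ∨ c ≡ a ∨ c ∨ b
  swap∨ a false false = refl
  swap∨ a false true  = refl
  swap∨ true true false = refl
  swap∨ false true false = refl
  swap∨ true true true = refl
  swap∨ false true true = refl

-- Contraction of the edge uv (v is merged into u; simple graph result)
contract : ∀ {m} → (G : Graph (suc m)) → (u v : Fin (suc m)) → Graph m
contract {m} G u v = record
  { adj    = A
  ; sym    = symA
  ; irrefl = irrA }
  where
  p : Fin m → Fin (suc m)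
  p = punchIn v
  isU : Fin m → Bool
  isU i = eqF (p i) u
  A : Fin m → Fin m → Bool
  A i j = not (eqF i j) ∧ (adj G (p i) (p j) ∨ (isU i ∧ adj G v (p j)) ∨ (isU j ∧ adj G (p i) v))
  symA : ∀ i j → A i j ≡ A j i
  symA i j rewrite eqF-sym i j | sym G (p i) (p j) | sym G v (p j) | sym G (p i) v
    = cong (not (eqF j i) ∧_) (swap∨ (adj G (p j) (p i)) (isU i ∧ adj G (p j) v) (isU j ∧ adj G v (p i)))
  irrA : ∀ i → A i i ≡ false
  irrA i rewrite eqF-refl i = refl

-- Induced subgraphs (up to relabelling): obtained by a sequence of vertex deletions
data InducedSub {n : ℕ} (G : Graph n) : ∀ {m} → Graph m → Set where
  here : InducedSub G G
  del  : ∀ {m} {H : Graph (suc m)} → InducedSub G H → (v : Fin (suc m)) → InducedSub G (H ─ v)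

data IMStep : ∀ {n} → Graph n → ∀ {m} → Graph m → Set where
  delᵢ : ∀ {m} {G : Graph (suc m)} (v : Fin (suc m)) → IMStep G (G ─ v)
  con  : ∀ {m} {G : Graph (suc m)} (u v : Fin (suc m)) → u ≢ v → adj G u v ≡ true
         → IMStep G (contract G u v)

data InducedMinor {n : ℕ} (G : Graph n) : ∀ {m} → Graph m → Set where
  here : InducedMinor G G
  step : ∀ {k m} {K : Graph k} {H : Graph m} → IMStep G K → InducedMinor K H → InducedMinor G H

ProperInducedMinor : ∀ {n m} → Graph n → Graph m → Set
ProperInducedMinor {n} G H = Σ ℕ (λ k → Σ (Graph k) (λ K → IMStep G K × InducedMinor K H))

data WalkAvoid {n : ℕ} (G : Graph n) (S : Subset n) : Fin n → Fin n → Set where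
  stop : ∀ {i} → i ∉ S → WalkAvoid G S i i
  go   : ∀ {i k j} → i ∉ S → adj G i k ≡ true → WalkAvoid G S k j → WalkAvoid G S i j

ConnectedAvoid : ∀ {n} → Graph n → Subset n → Set
ConnectedAvoid {n} G S = ∀ (i j : Fin n) → i ∉ S → j ∉ S → WalkAvoid G S i j

Connected : ∀ {n} → Graph n → Set
Connected G = ConnectedAvoid G ∅

TwoConnected : ∀ {n} → Graph n → Set
TwoConnected {n} G = (2 < n) × Connected G × (∀ v → ConnectedAvoid G ⁅ v ⁆ₛ)

CriticallyTwoConnected : ∀ {n} → Graph n → Set
CriticallyTwoConnected {zero}  G = TwoConnected G
CriticallyTwoConnected {suc m} G = TwoConnected G × (∀ v → ¬ TwoConnected (G ─ v))

TwoCograph : ∀ {n} → Graph n → Set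
TwoCograph {n} G = ∀ {m} (H : Graph m) → InducedSub G H → ¬ (TwoConnected H × TwoConnected (compl H))

MinimalNonTwoCograph : ∀ {n} → Graph n → Set
MinimalNonTwoCograph {n} G =
  (¬ TwoCograph G) × (∀ {m} (H : Graph m) → ProperInducedMinor G H → TwoCograph H)

KConnected : ℕ → ∀ {n} → Graph n → Set
KConnected k {n} G = (k < n) × (∀ (S : Subset n) → ∣ S ∣ < k → ConnectedAvoid G S)

VertexConnectivity : ∀ {n} → Graph n → ℕ → Set
VertexConnectivity G k = KConnected k G × ¬ KConnected (suc k) G

-- A minimal non-2-cograph G has G and its complement both 2-connected: every proper
-- induced subgraph is a proper induced minor, hence a 2-cograph, so only G itself can
-- witness that G is not one. Suppose neither is critically 2-connected, say G − v and
-- compl G − w are 2-connected. By minimality G − v and compl G − v = compl (G − v) are not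
-- both 2-connected, so compl G − v is not; as deleting a vertex from a 3-connected graph
-- leaves a 2-connected one, compl G is not 3-connected, and symmetrically neither is G.
-- All of these properties are decidable on finite graphs, which licenses the case split.
module Submission where

open import Defs
open import Data.Nat using (ℕ; zero; suc; _≤_; _<_; _+_; z≤n; s≤s; s<s⁻¹; _<?_)
open import Data.Nat.Properties using (≤-trans; <-irrefl; +-suc; +-identityʳ; +-monoˡ-≤; m≤n+m)
open import Data.Bool using (true; not; _∧_)
open import Data.Bool.Properties using () renaming (_≟_ to _≟ᵇ_)
open import Data.Fin using (Fin; zero; suc; punchIn; _≟_)
open import Data.Fin.Properties using (any?; all?; punchIn-injective; punchIn-punchOut)
open import Data.Fin.Subset using (Subset; _∈_; _∉_; _∪_; ∣_∣; _⊆_; inside; outside) renaming (⊥ to ∅; ⁅_⁆ to ⁅_⁆ₛ)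
open import Data.Fin.Subset.Properties using (_∈?_; nonempty?; Empty-unique; ⊆-antisym; ∈⊤; ∣⊤∣≡n; ∣⊥∣≡0; ∣⁅x⁆∣≡1; x∈⁅x⁆; x∈⁅y⁆⇒x≡y; x≢y⇒x∉⁅y⁆; p⊂q⇒∣p∣<∣q∣; p⊆p∪q; x∈p∪q⁻; x∈p∪q⁺)
open import Data.Vec using (_∷_; insertAt)
open import Data.Vec.Properties using (insertAt-lookup; insertAt-punchIn; []=⇒lookup; lookup⇒[]=)
open import Data.Product using (∃; _×_; _,_)
open import Data.Sum using (_⊎_; inj₁; inj₂; [_,_])
open import Data.Empty using (⊥-elim)
open import Relation.Nullary using (¬_; Dec; yes; no)
open import Relation.Nullary.Decidable using (map′; _×-dec_)
open import Relation.Binary.PropositionalEquality using (_≡_; _≢_; refl; trans; subst; cong) renaming (sym to ≡-sym)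
open import Function using (_∘_)

private
  variable
    n m : ℕ
    G H : Graph n
    S T : Subset n
    i j x : Fin n

∉-∪ : x ∉ S → x ∉ T → x ∉ S ∪ T
∉-∪ {S = S} {T = T} x∉S x∉T x∈S∪T = [ x∉S , x∉T ] (x∈p∪q⁻ S T x∈S∪T)

x∉p⇒∣p∣<n : (S : Subset n) → x ∉ S → ∣ S ∣ < n
x∉p⇒∣p∣<n {n = n} {x = x} S x∉S = subst (∣ S ∣ <_) (∣⊤∣≡n n) (p⊂q⇒∣p∣<∣q∣ ((λ _ → ∈⊤) , x , ∈⊤ , x∉S))

∣p∣<2⇒p≡⁅x⁆ : ∣ S ∣ < 2 → x ∈ S → S ≡ ⁅ x ⁆ₛ
∣p∣<2⇒p≡⁅x⁆ {S = S} {x = x} ∣S∣<2 x∈S = ⊆-antisym S⊆⁅x⁆ ⁅x⁆⊆S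
  where
  ⁅x⁆⊆S : ⁅ x ⁆ₛ ⊆ S
  ⁅x⁆⊆S y∈⁅x⁆ = subst (_∈ S) (≡-sym (x∈⁅y⁆⇒x≡y x y∈⁅x⁆)) x∈S
  S⊆⁅x⁆ : S ⊆ ⁅ x ⁆ₛ
  S⊆⁅x⁆ {y} y∈S with y ≟ x
  ... | yes refl = x∈⁅x⁆ x
  ... | no y≢x = ⊥-elim (<-irrefl refl (≤-trans ∣S∣<2 2≤∣S∣))
    where
    2≤∣S∣ : 2 ≤ ∣ S ∣
    2≤∣S∣ = subst (_< ∣ S ∣) (∣⁅x⁆∣≡1 x) (p⊂q⇒∣p∣<∣q∣ (⁅x⁆⊆S , y , y∈S , x≢y⇒x∉⁅y⁆ y≢x))

WalkAvoid-head∉ : WalkAvoid G S i j → i ∉ S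
WalkAvoid-head∉ (stop i∉S)   = i∉S
WalkAvoid-head∉ (go i∉S _ _) = i∉S

WalkAvoid-antimono : S ⊆ T → WalkAvoid G T i j → WalkAvoid G S i j
WalkAvoid-antimono S⊆T (stop i∉T)      = stop (i∉T ∘ S⊆T)
WalkAvoid-antimono S⊆T (go i∉T e walk) = go (i∉T ∘ S⊆T) e (WalkAvoid-antimono S⊆T walk)

WalkAvoid-resp-adj : (∀ i j → adj G i j ≡ adj H i j) → WalkAvoid G S i j → WalkAvoid H S i j
WalkAvoid-resp-adj G≗H (stop i∉S)              = stop i∉S
WalkAvoid-resp-adj G≗H (go {i} {k} i∉S e walk) =
  go i∉S (trans (≡-sym (G≗H i k)) e) (WalkAvoid-resp-adj G≗H walk)

TwoConnected-resp-adj : (∀ i j → adj G i j ≡ adj H i j) → TwoConnected G → TwoConnected H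
TwoConnected-resp-adj G≗H (2<n , conn , conn-v) =
  2<n , (λ i j i∉ j∉ → WalkAvoid-resp-adj G≗H (conn i j i∉ j∉))
      , (λ v i j i∉ j∉ → WalkAvoid-resp-adj G≗H (conn-v v i j i∉ j∉))

WalkAvoid-lastVisit : i ≢ j → WalkAvoid G S x j
  → WalkAvoid G (S ∪ ⁅ i ⁆ₛ) x j ⊎ ∃ λ k → adj G i k ≡ true × WalkAvoid G (S ∪ ⁅ i ⁆ₛ) k j
WalkAvoid-lastVisit i≢j (stop x∉S) = inj₁ (stop (∉-∪ x∉S (x≢y⇒x∉⁅y⁆ (i≢j ∘ ≡-sym))))
WalkAvoid-lastVisit {i = i} i≢j (go {x} x∉S e walk) with WalkAvoid-lastVisit i≢j walk
... | inj₂ later = inj₂ later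
... | inj₁ walk′ with x ≟ i
...   | yes refl = inj₂ (_ , e , walk′)
...   | no x≢i   = inj₁ (go (∉-∪ x∉S (x≢y⇒x∉⁅y⁆ x≢i)) e walk′)

WalkAvoid-viaNeighbour : i ≢ j → WalkAvoid G S i j
  → ∃ λ k → adj G i k ≡ true × WalkAvoid G (S ∪ ⁅ i ⁆ₛ) k j
WalkAvoid-viaNeighbour {i = i} i≢j walk with WalkAvoid-lastVisit i≢j walk
... | inj₁ walk′ = ⊥-elim (WalkAvoid-head∉ walk′ (x∈p∪q⁺ (inj₂ (x∈⁅x⁆ i))))
... | inj₂ later = later

-- Each search step adds the start vertex to S, so the fuel k with n ≤ ∣ S ∣ + k never runs out.
walkAvoid? : (G : Graph n) (S : Subset n) (i j : Fin n) → i ∉ S → Dec (WalkAvoid G S i j)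
walkAvoid? {n} G S i j = search n S (m≤n+m n ∣ S ∣) i j
  where
  search : ∀ k S → n ≤ ∣ S ∣ + k → ∀ i j → i ∉ S → Dec (WalkAvoid G S i j)
  search zero S n≤∣S∣ i j i∉S =
    ⊥-elim (<-irrefl refl (≤-trans (x∉p⇒∣p∣<n S i∉S) (subst (n ≤_) (+-identityʳ ∣ S ∣) n≤∣S∣)))
  search (suc k) S n≤∣S∣+1+k i j i∉S with i ≟ j
  ... | yes refl = yes (stop i∉S)
  ... | no i≢j = map′ (λ (x , e , walk) → go i∉S e (WalkAvoid-antimono (p⊆p∪q ⁅ i ⁆ₛ) walk))
                      (WalkAvoid-viaNeighbour i≢j)
                      (any? stepTo?)
    where
    S′ = S ∪ ⁅ i ⁆ₛ
    n≤∣S′∣+k : n ≤ ∣ S′ ∣ + k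
    n≤∣S′∣+k = ≤-trans n≤∣S∣+1+k (subst (_≤ ∣ S′ ∣ + k) (≡-sym (+-suc ∣ S ∣ k)) (+-monoˡ-≤ k
                 (p⊂q⇒∣p∣<∣q∣ (p⊆p∪q ⁅ i ⁆ₛ , i , x∈p∪q⁺ (inj₂ (x∈⁅x⁆ i)) , i∉S))))
    stepTo? : ∀ x → Dec (adj G i x ≡ true × WalkAvoid G S′ x j)
    stepTo? x with x ∈? S′
    ... | yes x∈S′ = no (λ (_ , walk) → WalkAvoid-head∉ walk x∈S′)
    ... | no x∉S′  = (adj G i x ≟ᵇ true) ×-dec search k S′ n≤∣S′∣+k x j x∉S′

ConnectedAvoid? : (G : Graph n) (S : Subset n) → Dec (ConnectedAvoid G S)
ConnectedAvoid? G S = all? (λ i → all? (λ j → walkIfOutside? i j))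
  where
  walkIfOutside? : ∀ i j → Dec (i ∉ S → j ∉ S → WalkAvoid G S i j)
  walkIfOutside? i j with i ∈? S | j ∈? S
  ... | yes i∈S | _       = yes (λ i∉S _ → ⊥-elim (i∉S i∈S))
  ... | no _    | yes j∈S = yes (λ _ j∉S → ⊥-elim (j∉S j∈S))
  ... | no i∉S  | no j∉S  = map′ (λ walk _ _ → walk) (λ f → f i∉S j∉S) (walkAvoid? G S i j i∉S)

TwoConnected? : (G : Graph n) → Dec (TwoConnected G)
TwoConnected? {n} G = (2 <? n) ×-dec (ConnectedAvoid? G ∅ ×-dec all? (λ v → ConnectedAvoid? G ⁅ v ⁆ₛ))

eqF-punchIn : (v : Fin (suc m)) (i j : Fin m) → eqF (punchIn v i) (punchIn v j) ≡ eqF i j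
eqF-punchIn zero    i       j       = refl
eqF-punchIn (suc v) zero    zero    = refl
eqF-punchIn (suc v) zero    (suc j) = refl
eqF-punchIn (suc v) (suc i) zero    = refl
eqF-punchIn (suc v) (suc i) (suc j) = eqF-punchIn v i j

compl-─ : (G : Graph (suc m)) (v : Fin (suc m)) (i j : Fin m)
        → adj (compl G ─ v) i j ≡ adj (compl (G ─ v)) i j
compl-─ G v i j = cong (λ b → not b ∧ not (adj G (punchIn v i) (punchIn v j))) (eqF-punchIn v i j)

-- For S ⊆ V(H ─ w), insertAt S w inside is the set S + w in H.
∣insertAt-inside∣ : (S : Subset m) (w : Fin (suc m)) → ∣ insertAt S w inside ∣ ≡ suc ∣ S ∣
∣insertAt-inside∣ S             zero    = refl
∣insertAt-inside∣ (inside ∷ S)  (suc w) = cong suc (∣insertAt-inside∣ S w)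
∣insertAt-inside∣ (outside ∷ S) (suc w) = ∣insertAt-inside∣ S w

∈-insertAt : (S : Subset m) (w : Fin (suc m)) → w ∈ insertAt S w inside
∈-insertAt S w = lookup⇒[]= w _ (insertAt-lookup S w inside)

punchIn-∈-insertAt⁺ : (S : Subset m) (w : Fin (suc m)) → x ∈ S → punchIn w x ∈ insertAt S w inside
punchIn-∈-insertAt⁺ {x = x} S w x∈S =
  lookup⇒[]= (punchIn w x) _ (trans (insertAt-punchIn S w inside x) ([]=⇒lookup x∈S))

punchIn-∈-insertAt⁻ : (S : Subset m) (w : Fin (suc m)) → punchIn w x ∈ insertAt S w inside → x ∈ S
punchIn-∈-insertAt⁻ {x = x} S w x∈ =
  lookup⇒[]= x S (trans (≡-sym (insertAt-punchIn S w inside x)) ([]=⇒lookup x∈))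

WalkAvoid-─ : (H : Graph (suc m)) (w : Fin (suc m)) {S : Subset m} {a b : Fin m}
  → WalkAvoid H (insertAt S w inside) (punchIn w a) (punchIn w b) → WalkAvoid (H ─ w) S a b
WalkAvoid-─ H w {S} walk = lower walk refl refl
  where
  lower : ∀ {y z a b} → WalkAvoid H (insertAt S w inside) y z
        → punchIn w a ≡ y → punchIn w b ≡ z → WalkAvoid (H ─ w) S a b
  lower {a = a} {b} (stop y∉) refl pb≡pa =
    subst (WalkAvoid (H ─ w) S a) (punchIn-injective w a b (≡-sym pb≡pa))
          (stop (y∉ ∘ punchIn-∈-insertAt⁺ S w))
  lower {a = a} (go {k = k} y∉ e walk) refl pb≡z =
    go (y∉ ∘ punchIn-∈-insertAt⁺ S w)
       (subst (λ t → adj H (punchIn w a) t ≡ true) (≡-sym (punchIn-punchOut w≢k)) e)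
       (lower walk (punchIn-punchOut w≢k) pb≡z)
    where
    w≢k : w ≢ k
    w≢k refl = WalkAvoid-head∉ walk (∈-insertAt S w)

KConnected-─ : ∀ {k} (H : Graph (suc m)) (w : Fin (suc m)) → KConnected (suc k) H → KConnected k (H ─ w)
KConnected-─ {k = k} H w (1+k<1+m , conn) = s<s⁻¹ 1+k<1+m , connected
  where
  connected : ∀ S → ∣ S ∣ < k → ConnectedAvoid (H ─ w) S
  connected S ∣S∣<k i j i∉S j∉S = WalkAvoid-─ H w
    (conn (insertAt S w inside) (subst (_< suc k) (≡-sym (∣insertAt-inside∣ S w)) (s≤s ∣S∣<k))
          (punchIn w i) (punchIn w j) (i∉S ∘ punchIn-∈-insertAt⁻ S w) (j∉S ∘ punchIn-∈-insertAt⁻ S w))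

TwoConnected⇒KConnected-2 : TwoConnected G → KConnected 2 G
TwoConnected⇒KConnected-2 {G = G} (2<n , conn , conn-v) = 2<n , connected
  where
  connected : ∀ S → ∣ S ∣ < 2 → ConnectedAvoid G S
  connected S ∣S∣<2 with nonempty? S
  ... | yes (x , x∈S) = subst (ConnectedAvoid G) (≡-sym (∣p∣<2⇒p≡⁅x⁆ ∣S∣<2 x∈S)) (conn-v x)
  ... | no empty      = subst (ConnectedAvoid G) (≡-sym (Empty-unique empty)) conn

KConnected-2⇒TwoConnected : ∀ {n} {G : Graph n} → KConnected 2 G → TwoConnected G
KConnected-2⇒TwoConnected {n = n} (2<n , conn) =
  2<n , conn ∅ (subst (_< 2) (≡-sym (∣⊥∣≡0 n)) (s≤s z≤n))
      , λ v → conn ⁅ v ⁆ₛ (subst (_< 2) (≡-sym (∣⁅x⁆∣≡1 v)) (s≤s (s≤s z≤n)))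

VertexConnectivity-2 : (H : Graph (suc m)) (w : Fin (suc m))
  → TwoConnected H → ¬ TwoConnected (H ─ w) → VertexConnectivity H 2
VertexConnectivity-2 H w tc ¬tc-w =
  TwoConnected⇒KConnected-2 tc , ¬tc-w ∘ KConnected-2⇒TwoConnected ∘ KConnected-─ H w

critical⊎deletable : (G : Graph (suc m)) → TwoConnected G
  → CriticallyTwoConnected G ⊎ ∃ λ v → TwoConnected (G ─ v)
critical⊎deletable G tc with any? (λ v → TwoConnected? (G ─ v))
... | yes deletable = inj₂ deletable
... | no ¬deletable = inj₁ (tc , λ v tc-v → ¬deletable (v , tc-v))

InducedMinor-snoc : ∀ {p} {H′ : Graph p} → InducedMinor G H → IMStep H H′ → InducedMinor G H′
InducedMinor-snoc here          s = step s here
InducedMinor-snoc (step s₀ ops) s = step s₀ (InducedMinor-snoc ops s)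

InducedSub-─⇒ProperInducedMinor : {H : Graph (suc m)} → InducedSub G H → ∀ v → ProperInducedMinor G (H ─ v)
InducedSub-─⇒ProperInducedMinor here          v = _ , _ , delᵢ v , here
InducedSub-─⇒ProperInducedMinor (del sub u) v with InducedSub-─⇒ProperInducedMinor sub u
... | k , K , first , rest = k , K , first , InducedMinor-snoc rest (delᵢ v)

MinimalNonTwoCograph⇒TwoConnected : MinimalNonTwoCograph G → TwoConnected G × TwoConnected (compl G)
MinimalNonTwoCograph⇒TwoConnected {G = G} (¬cograph , minimal)
  with TwoConnected? G ×-dec TwoConnected? (compl G)
... | yes both = both
... | no ¬both = ⊥-elim (¬cograph cograph)
  where
  cograph : TwoCograph G
  cograph _ here        = ¬both
  cograph _ (del sub v) = minimal _ (InducedSub-─⇒ProperInducedMinor sub v) _ here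

MinimalNonTwoCograph-─ : (G : Graph (suc m)) → MinimalNonTwoCograph G
  → ∀ v → ¬ (TwoConnected (G ─ v) × TwoConnected (compl G ─ v))
MinimalNonTwoCograph-─ G (_ , minimal) v (tc-v , tc̄-v) =
  minimal (G ─ v) (_ , _ , delᵢ v , here) _ here (tc-v , TwoConnected-resp-adj (compl-─ G v) tc̄-v)

lemma3p11 : ∀ {n : ℕ} (G : Graph n) → MinimalNonTwoCograph G → MinimalNonTwoCograph (compl G)
    → CriticallyTwoConnected G ⊎ CriticallyTwoConnected (compl G)
      ⊎ (VertexConnectivity G 2 × VertexConnectivity (compl G) 2)
lemma3p11 {zero} G minG _ with MinimalNonTwoCograph⇒TwoConnected minG
... | (() , _) , _
lemma3p11 {suc m} G minG _ with MinimalNonTwoCograph⇒TwoConnected minG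
... | tc , tc̄ with critical⊎deletable G tc | critical⊎deletable (compl G) tc̄
...   | inj₁ critical | _             = inj₁ critical
...   | inj₂ _        | inj₁ critical = inj₂ (inj₁ critical)
...   | inj₂ (v , tc-v) | inj₂ (w , tc̄-w) = inj₂ (inj₂
          ( VertexConnectivity-2 G w tc (λ tc-w → MinimalNonTwoCograph-─ G minG w (tc-w , tc̄-w))
          , VertexConnectivity-2 (compl G) v tc̄ (λ tc̄-v → MinimalNonTwoCograph-─ G minG v (tc-v , tc̄-v))))
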